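{- Fix $k\in\mathbb{N}$. (a) For every $\eta\in V_k$, $Ir(\{\eta\})$ is a subsemigroup of $(V_k,+)$. (b) The family $\{Ir(\{\eta\}):\eta\in V_k\}$ has the finite intersection property. (c) For every finite subset $\{\eta_1,\ldots,\eta_m\}$ of $V_k$, the set $Ir(\{\eta_1,\ldots,\eta_m\})=\bigcap_{i=1}^m Ir(\{\eta_i\})$ is a subsemigroup of $(V_k,+)$.
   Context: $\Gamma_k$ is the set of formal strings $x=(a_01_0)(a_11_1)\cdots(a_i1_i)$ with $i\in\{1,\ldots,k\}$ and $a_0,\ldots,a_i\in\mathbb{Z}$; two strings are equal iff they have the same length $i$ and the same entries. Put $\iota(x)=a_0$, $l(x)=i$. Two strings $x,y$ are compatible if $\iota(x)=\iota(y)$ and $l(x)=l(y)$, and irreducible otherwise; a finite set of strings is irreducible if its elements are pairwise irreducible. For compatible $x=(a_01_0)(a_11_1)\cdots(a_i1_i)$, $y=(a_01_0)(b_11_1)\cdots(b_i1_i)$ put $x+y=(a_01_0)((a_1+b_1)1_1)\cdots((a_i+b_i)1_i)$. $V_k$ consists of formal sums $\gamma=x_1+\cdots+x_n$ ($n\ge1$) with $\{x_1,\ldots,x_n\}\subseteq\Gamma_k$ an irreducible set; $\mathrm{Term}(\gamma)=\{x_1,\ldots,x_n\}$, and sums are equal iff they have the same set of terms. For $\gamma,\mu\in V_k$, $\mathrm{Term}(\gamma+\mu)$ consists of the terms of $\gamma$ compatible with no term of $\mu$, the terms of $\mu$ compatible with no term of $\gamma$, and $a+b$ for each compatible pair $(a,b)\in\mathrm{Term}(\gamma)\times\mathrm{Term}(\mu)$.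 For $\eta\in V_k$, $Ir(\{\eta\})=\{y\in V_k:\mathrm{Term}(y)\cup\mathrm{Term}(\eta)\text{ is an irreducible subset of }\Gamma_k\}$. -}

module Defs where

open import Data.Nat as ℕ using (ℕ; suc)
open import Data.Nat.Properties using (suc-injective)
open import Data.Fin using (Fin; toℕ)
open import Data.Fin.Properties using (toℕ-injective)
open import Data.Integer as ℤ using (ℤ)
open import Data.Vec using (Vec; zipWith)
open import Data.List using (List; []; _∷_; _++_; filter; concatMap)
open import Data.List.Relation.Unary.Any using (Any; any?)
open import Data.List.Relation.Unary.AllPairs using (AllPairs)
open import Data.Product using (_×_; _,_; proj₂)
open import Relation.Nullary using (¬_; Dec; yes; no; ¬?)
open import Relation.Nullary.Decidable using (_×-dec_)
open import Relation.Binary.PropositionalEquality using (_≡_; subst; sym; cong)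

-- Γ_k : a string (a₀1₀)(a₁1₁)⋯(a_i1_i) with i ∈ {1,…,k}.
-- We store  len = i - 1 : Fin k  (so i = suc (toℕ len) ranges over 1..k),
-- the initial entry a₀ and the remaining entries a₁,…,a_i as a vector of length i.
record Γ (k : ℕ) : Set where
  constructor mkΓ
  field
    len  : Fin k
    a₀   : ℤ
    rest : Vec ℤ (suc (toℕ len))
open Γ public

ι : ∀ {k} → Γ k → ℤ
ι = a₀

l : ∀ {k} → Γ k → ℕ
l x = suc (toℕ (len x))

Compatible : ∀ {k} → Γ k → Γ k → Set
Compatible x y = (ι x ≡ ι y) × (l x ≡ l y)

Irreducible : ∀ {k} → Γ k → Γ k → Set
Irreducible x y = ¬ Compatible x y

compatible? : ∀ {k} (x y : Γ k) → Dec (Compatible x y)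
compatible? x y = (ι x ℤ.≟ ι y) ×-dec (l x ℕ.≟ l y)

addΓ : ∀ {k} (x y : Γ k) → Compatible x y → Γ k
addΓ x y (_ , p) =
  mkΓ (len x) (a₀ x)
      (zipWith ℤ._+_ (rest x)
        (subst (λ j → Vec ℤ (suc (toℕ j))) (sym (toℕ-injective (suc-injective p))) (rest y)))

-- A finite set of strings, given as a list, is irreducible:
-- its entries are pairwise irreducible (in particular, no repetitions).
IrreducibleSet : ∀ {k} → List (Γ k) → Set
IrreducibleSet = AllPairs Irreducible

-- V_k : formal sums x₁ + ⋯ + x_n (n ≥ 1) with irreducible set of terms;
-- an element is represented by the list of its terms.
NonEmpty : ∀ {A : Set} → List A → Set
NonEmpty xs = ¬ (xs ≡ [])

IsV : ∀ {k} → List (Γ k) → Set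
IsV γ = NonEmpty γ × IrreducibleSet γ

sumsWith : ∀ {k} → Γ k → List (Γ k) → List (Γ k)
sumsWith a [] = []
sumsWith a (b ∷ bs) with compatible? a b
... | yes c = addΓ a b c ∷ sumsWith a bs
... | no _  = sumsWith a bs

_⊕_ : ∀ {k} → List (Γ k) → List (Γ k) → List (Γ k)
γ ⊕ μ =
  filter (λ a → ¬? (any? (compatible? a) μ)) γ
  ++ filter (λ b → ¬? (any? (compatible? b) γ)) μ
  ++ concatMap (λ a → sumsWith a μ) γ

_∈Ir_ : ∀ {k} → List (Γ k) → List (Γ k) → Set
y ∈Ir η = IsV y × IrreducibleSet (y ++ η)

_∈IrFam_ : ∀ {k m} → List (Γ k) → (Fin m → List (Γ k)) → Set
y ∈IrFam η = ∀ i → y ∈Ir η i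

{-# OPTIONS --safe #-}
module Submission where

-- Compatibility is an equivalence relation, and a sum a + b is compatible with
-- both a and b. So every term of γ + μ is compatible with a term of γ or of μ,
-- and any property of terms that is invariant under compatibility (such as
-- being irreducible with every term of η) passes from γ and μ to γ + μ.
-- Pairwise irreducibility of the terms of γ + μ follows the same way: sums
-- a + b and a′ + b′ of distinct terms a, a′ of γ are separated because a and a′
-- are, and sums a + b and a + b′ because b and b′ are.
-- For the finite intersection property, a string whose initial entry exceeds
-- every initial entry occurring in η₁, …, η_m is irreducible with all of them.

open import Defs
open import Data.Nat using (ℕ; zero; suc; _≤_)
open import Data.Fin using (Fin)
import Data.Fin as Fin
open import Data.Integer as ℤ using (ℤ; 0ℤ; 1ℤ)
import Data.Integer.Properties as ℤ
open import Data.List using (List; []; _∷_; _++_; map; concat; concatMap; filter; tabulate)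
open import Data.List.Properties using (++-conicalˡ; ++-conicalʳ; filter-accept)
open import Data.List.Extrema ℤ.≤-totalOrder using (max; xs≤max)
open import Data.List.Relation.Unary.All as All using (All; []; _∷_)
import Data.List.Relation.Unary.All.Properties as All
open import Data.List.Relation.Unary.Any using (Any; here; there; any?)
open import Data.List.Relation.Unary.AllPairs as AllPairs using (AllPairs; []; _∷_)
import Data.List.Relation.Unary.AllPairs.Properties as AllPairs
open import Data.Product using (_×_; _,_; ∃; proj₂)
open import Data.Empty using (⊥-elim)
open import Data.Vec using () renaming ([] to []ᵥ; _∷_ to _∷ᵥ_)
open import Function using (_∘_)
open import Relation.Nullary using (¬_; Dec; yes; no; ¬?)
open import Relation.Binary.Core using (Rel)
open import Relation.Binary.PropositionalEquality using (refl; sym; trans; subst)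

AllPairs-++⁻ : ∀ {a r} {A : Set a} {R : Rel A r} (xs : List A) {ys : List A} →
  AllPairs R (xs ++ ys) →
  AllPairs R xs × AllPairs R ys × All (λ x → All (R x) ys) xs
AllPairs-++⁻ []       rs         = [] , rs , []
AllPairs-++⁻ (x ∷ xs) (rx ∷ rxs) with AllPairs-++⁻ xs rxs
... | rs₁ , rs₂ , rs₁₂ = All.++⁻ˡ xs rx ∷ rs₁ , rs₂ , All.++⁻ʳ xs rx ∷ rs₁₂

module _ {A : Set} where

  ++-nonemptyˡ : (xs ys : List A) → NonEmpty xs → NonEmpty (xs ++ ys)
  ++-nonemptyˡ xs ys xs≢[] = xs≢[] ∘ ++-conicalˡ xs ys

  ++-nonemptyʳ : (xs ys : List A) → NonEmpty ys → NonEmpty (xs ++ ys)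
  ++-nonemptyʳ xs ys ys≢[] = ys≢[] ∘ ++-conicalʳ xs ys

module _ {k : ℕ} where

  Apart : List (Γ k) → List (Γ k) → Set
  Apart xs ys = All (λ x → All (Irreducible x) ys) xs

  Invariant : (Γ k → Set) → Set
  Invariant P = (x y : Γ k) → Compatible x y → P x → P y

  irreducible-invariantʳ : (x : Γ k) → Invariant (Irreducible x)
  irreducible-invariantʳ x y z (p , q) x≁y (p′ , q′) =
    x≁y (trans p′ (sym p) , trans q′ (sym q))

  irreducible-invariantˡ : (y : Γ k) → Invariant (λ x → Irreducible x y)
  irreducible-invariantˡ y x z (p , q) x≁y (p′ , q′) = x≁y (trans p p′ , trans q q′)

  apart-invariant : (ys : List (Γ k)) → Invariant (λ x → All (Irreducible x) ys)
  apart-invariant ys x z x~z = All.map (λ {y} → irreducible-invariantˡ y x z x~z)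

  addΓ-compatibleˡ : (a b : Γ k) (c : Compatible a b) → Compatible a (addΓ a b c)
  addΓ-compatibleˡ a b c = refl , refl

  addΓ-compatibleʳ : (a b : Γ k) (c : Compatible a b) → Compatible b (addΓ a b c)
  addΓ-compatibleʳ a b (p , q) = sym p , sym q

  module _ {P : Γ k → Set} (inv : Invariant P) where

    sumsWith-invariantˡ : (a : Γ k) → P a → (bs : List (Γ k)) → All P (sumsWith a bs)
    sumsWith-invariantˡ a pa []       = []
    sumsWith-invariantˡ a pa (b ∷ bs) with compatible? a b
    ... | yes c = inv a (addΓ a b c) (addΓ-compatibleˡ a b c) pa
                ∷ sumsWith-invariantˡ a pa bs
    ... | no _  = sumsWith-invariantˡ a pa bs

    sumsWith-invariantʳ : (a : Γ k) {bs : List (Γ k)} → All P bs → All P (sumsWith a bs)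
    sumsWith-invariantʳ a []                   = []
    sumsWith-invariantʳ a {b ∷ _} (pb ∷ pbs) with compatible? a b
    ... | yes c = inv b (addΓ a b c) (addΓ-compatibleʳ a b c) pb
                ∷ sumsWith-invariantʳ a pbs
    ... | no _  = sumsWith-invariantʳ a pbs

  sums : List (Γ k) → List (Γ k) → List (Γ k)
  sums γ μ = concatMap (λ a → sumsWith a μ) γ

  module _ {P : Γ k → Set} (inv : Invariant P) where

    sums-invariantˡ : {γ : List (Γ k)} → All P γ → (μ : List (Γ k)) → All P (sums γ μ)
    sums-invariantˡ pγ μ =
      All.concat⁺ (All.map⁺ (All.map (λ {a} pa → sumsWith-invariantˡ inv a pa μ) pγ))

    sums-invariantʳ : (γ : List (Γ k)) {μ : List (Γ k)} → All P μ → All P (sums γ μ)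
    sums-invariantʳ γ pμ =
      All.concat⁺ (All.map⁺ (All.universal (λ a → sumsWith-invariantʳ inv a pμ) γ))

  sumsWith-pairwise : (a : Γ k) {bs : List (Γ k)} →
    IrreducibleSet bs → IrreducibleSet (sumsWith a bs)
  sumsWith-pairwise a []                   = []
  sumsWith-pairwise a {b ∷ _} (b#bs ∷ bs-pw) with compatible? a b
  ... | yes c = sumsWith-invariantʳ (irreducible-invariantʳ (addΓ a b c)) a
                  (All.map (λ {b′} → irreducible-invariantˡ b′ b (addΓ a b c)
                                       (addΓ-compatibleʳ a b c)) b#bs)
              ∷ sumsWith-pairwise a bs-pw
  ... | no _  = sumsWith-pairwise a bs-pw

  sumsWith-apart : {a a′ : Γ k} (μ : List (Γ k)) →
    Irreducible a a′ → Apart (sumsWith a μ) (sumsWith a′ μ)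
  sumsWith-apart {a} {a′} μ a≁a′ =
    sumsWith-invariantˡ (apart-invariant (sumsWith a′ μ)) a
      (sumsWith-invariantˡ (irreducible-invariantʳ a) a′ a≁a′ μ) μ

  sums-pairwise : {γ μ : List (Γ k)} →
    IrreducibleSet γ → IrreducibleSet μ → IrreducibleSet (sums γ μ)
  sums-pairwise {γ} {μ} γ-pw μ-pw =
    AllPairs.concat⁺
      (All.map⁺ (All.universal (λ a → sumsWith-pairwise a μ-pw) γ))
      (AllPairs.map⁺ (AllPairs.map (sumsWith-apart μ) γ-pw))

  unmatched : List (Γ k) → List (Γ k) → List (Γ k)
  unmatched γ μ = filter (λ a → ¬? (any? (compatible? a) μ)) γ

  unmatched-apart : (γ μ : List (Γ k)) → Apart (unmatched γ μ) μ
  unmatched-apart γ μ = All.map (All.¬Any⇒All¬ μ) (All.all-filter _ γ)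

  ⊕-invariant : {P : Γ k → Set} → Invariant P →
    {y z : List (Γ k)} → All P y → All P z → All P (y ⊕ z)
  ⊕-invariant inv {y} {z} py pz =
    All.++⁺ (All.filter⁺ _ py) (All.++⁺ (All.filter⁺ _ pz) (sums-invariantˡ inv py z))

  ⊕-pairwise : {y z : List (Γ k)} →
    IrreducibleSet y → IrreducibleSet z → IrreducibleSet (y ⊕ z)
  ⊕-pairwise {y} {z} y-pw z-pw =
    AllPairs.++⁺ (AllPairs.filter⁺ _ y-pw)
      (AllPairs.++⁺ (AllPairs.filter⁺ _ z-pw) (sums-pairwise y-pw z-pw) unmatchedʳ#sums)
      unmatchedˡ#rest
    where
    unmatchedʳ#sums : Apart (unmatched z y) (sums y z)
    unmatchedʳ#sums =
      All.map (λ {t} t#y → sums-invariantˡ (irreducible-invariantʳ t) t#y z)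
        (unmatched-apart z y)

    unmatchedˡ#rest : Apart (unmatched y z) (unmatched z y ++ sums y z)
    unmatchedˡ#rest =
      All.map (λ {t} t#z → All.++⁺ (All.filter⁺ _ t#z)
                                   (sums-invariantʳ (irreducible-invariantʳ t) y t#z))
        (unmatched-apart y z)

  sumsWith-nonempty : (a : Γ k) (bs : List (Γ k)) →
    Any (Compatible a) bs → NonEmpty (sumsWith a bs)
  sumsWith-nonempty a (b ∷ bs) a~bs with compatible? a b | a~bs
  ... | yes _   | _           = λ ()
  ... | no a≁b  | here a~b    = ⊥-elim (a≁b a~b)
  ... | no _    | there a~bs′ = sumsWith-nonempty a bs a~bs′

  -- The first term a of y survives in y + z: unmatched, or inside a sum a + b.
  ⊕-nonempty : {y : List (Γ k)} (z : List (Γ k)) → NonEmpty y → NonEmpty (y ⊕ z)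
  ⊕-nonempty {[]}    z y≢[] = ⊥-elim (y≢[] refl)
  ⊕-nonempty {a ∷ y} z _    = by-cases (any? (compatible? a) z)
    where
    by-cases : Dec (Any (Compatible a) z) → NonEmpty ((a ∷ y) ⊕ z)
    by-cases (yes a~z) =
      ++-nonemptyʳ (unmatched (a ∷ y) z) _
        (++-nonemptyʳ (unmatched z (a ∷ y)) _
          (++-nonemptyˡ (sumsWith a z) (sums y z) (sumsWith-nonempty a z a~z)))
    by-cases (no a≁z) =
      ++-nonemptyˡ (unmatched (a ∷ y) z) _
        (subst NonEmpty (sym (filter-accept (λ x → ¬? (any? (compatible? x) z)) a≁z)) λ ())

  ⊕-preserves-∈Ir : {η y z : List (Γ k)} → y ∈Ir η → z ∈Ir η → (y ⊕ z) ∈Ir η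
  ⊕-preserves-∈Ir {η} {y} {z} ((y≢[] , _) , yη-pw) (_ , zη-pw)
    with AllPairs-++⁻ y yη-pw | AllPairs-++⁻ z zη-pw
  ... | y-pw , η-pw , y#η | z-pw , _ , z#η =
    (⊕-nonempty z y≢[] , yz-pw)
    , AllPairs.++⁺ yz-pw η-pw (⊕-invariant (apart-invariant η) y#η z#η)
    where
    yz-pw : IrreducibleSet (y ⊕ z)
    yz-pw = ⊕-pairwise y-pw z-pw

V₀-empty : (xs : List (Γ 0)) → ¬ IsV xs
V₀-empty []               (xs≢[] , _) = xs≢[] refl
V₀-empty (mkΓ () _ _ ∷ _) _

module _ {k m : ℕ} (η : Fin m → List (Γ k)) where

  initialEntries : List ℤ
  initialEntries = concat (tabulate (map ι ∘ η))

  freshEntry : ℤ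
  freshEntry = ℤ.suc (max 0ℤ initialEntries)

  ι<freshEntry : (i : Fin m) → All (λ e → ι e ℤ.< freshEntry) (η i)
  ι<freshEntry i =
    All.map (λ e≤max → ℤ.suc[i]≤j⇒i<j (ℤ.+-monoʳ-≤ 1ℤ e≤max))
      (All.map⁻ (All.tabulate⁻ (All.concat⁻ (xs≤max 0ℤ initialEntries)) i))

fresh-∈IrFam : {k m : ℕ} (η : Fin m → List (Γ (suc k))) →
  (∀ i → IrreducibleSet (η i)) → ∃ λ y → y ∈IrFam η
fresh-∈IrFam η η-pw = w ∷ [] , λ i → ((λ ()) , [] ∷ []) , w#η i ∷ η-pw i
  where
  w : Γ _
  w = mkΓ Fin.zero (freshEntry η) (0ℤ ∷ᵥ []ᵥ)

  w#η : ∀ i → All (Irreducible w) (η i)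
  w#η i = All.map (λ e<w (w≡e , _) → ℤ.<⇒≢ e<w (sym w≡e)) (ι<freshEntry η i)

Ir-finiteIntersection : (k m : ℕ) → 1 ≤ m → (η : Fin m → List (Γ k)) →
  (∀ i → IsV (η i)) → ∃ λ y → y ∈IrFam η
Ir-finiteIntersection zero    (suc _) _ η η-V = ⊥-elim (V₀-empty (η Fin.zero) (η-V Fin.zero))
Ir-finiteIntersection (suc k) _       _ η η-V = fresh-∈IrFam η (proj₂ ∘ η-V)

mainTheorem5 : (k : ℕ) →
    -- (a) Ir({η}) is closed under + (a subsemigroup of (V_k,+))
    ((η : List (Γ k)) → IsV η →
      (y z : List (Γ k)) → y ∈Ir η → z ∈Ir η → (y ⊕ z) ∈Ir η)
    -- (b) finite intersection property of {Ir({η}) : η ∈ V_k}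
    × ((m : ℕ) → 1 ≤ m → (η : Fin m → List (Γ k)) → (∀ i → IsV (η i)) →
      ∃ λ (y : List (Γ k)) → y ∈IrFam η)
    -- (c) Ir({η₁,…,η_m}) = ⋂ᵢ Ir({ηᵢ}) is closed under +
    × ((m : ℕ) → 1 ≤ m → (η : Fin m → List (Γ k)) → (∀ i → IsV (η i)) →
      (y z : List (Γ k)) → y ∈IrFam η → z ∈IrFam η → (y ⊕ z) ∈IrFam η)
mainTheorem5 k =
    (λ _ _ _ _ → ⊕-preserves-∈Ir)
  , Ir-finiteIntersection k
  , (λ _ _ _ _ _ _ y∈ z∈ i → ⊕-preserves-∈Ir (y∈ i) (z∈ i))
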